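{- Let $A$ and $B$ be satisfiable quantifier-free symbolic heaps of array separation logic, written $$A=\Pi:\mathop{*}_{i=1}^n\mathsf{array}(a_i,b_i)*\mathop{*}_{i=1}^k t_i\mapsto u_i,\qquad B=\Pi':\mathop{*}_{i=1}^m\mathsf{array}(c_i,d_i)*\mathop{*}_{i=1}^{\ell} v_i\mapsto w_i.$$ If there exist quantifier-free symbolic heaps $X,Y$ such that $A*X$ is satisfiable and $A*X\models B*Y$, then the Presburger formula $\beta(A,B)$ is satisfiable.
   Context: ASL: terms $t ::= x\mid n\mid t+t\mid n t$; pure formulas are conjunctions of $t=t,t\neq t,t\le t,t<t$; spatial formulas $F::=\mathsf{emp}\mid t\mapsto t\mid\mathsf{array}(t,t)\mid F*F$; quantifier-free symbolic heaps $\Pi:F$. Stacks $s:\mathsf{Var}\to\mathbb{N}$, heaps finite partial maps $\mathbb{N}\rightharpoonup\mathbb{N}$, $h_1\circ h_2$ union of domain-disjoint heaps. $s,h\models\mathsf{emp}$ iff $h$ empty; $s,h\models t_1\mapsto t_2$ iff $\mathrm{dom}(h)=\{s(t_1)\}$ and $h(s(t_1))=s(t_2)$; $s,h\models\mathsf{array}(t_1,t_2)$ iff $s(t_1)\le s(t_2)$ and $\mathrm{dom}(h)=\{s(t_1),\dots,s(t_2)\}$; $s,h\models F_1*F_2$ iff $h=h_1\circ h_2$ with $s,h_i\models F_i$; pure atoms evaluated arithmetically. $A\models B$ means every $(s,h)$ satisfying $A$ satisfies $B$. For quantifier-free symbolic heaps, $(\Pi:F)*(\Pi':F')=\Pi\wedge\Pi':F*F'$.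 For a quantifier-free $C$, let $\lfloor C\rfloor$ replace every $c\mapsto d$ by $\mathsf{array}(c,c)$; if $\lfloor C\rfloor=\Pi:\mathop{*}_{i=1}^N\mathsf{array}(\hat a_i,\hat b_i)$ then $\gamma(C)=\Pi\wedge\bigwedge_{i}\hat a_i\le\hat b_i\wedge\bigwedge_{i<j}((\hat b_i<\hat a_j)\vee(\hat b_j<\hat a_i))$. Define $\beta(A,B)=\gamma(A)\wedge\gamma(B)\wedge\bigwedge_{j=1}^{\ell}\bigwedge_{i=1}^{n}(v_j<a_i\vee v_j>b_i)\wedge\bigwedge_{i=1}^{k}\bigwedge_{j=1}^{\ell}(t_i\neq v_j\vee u_i=w_j)$. -}

module Defs where

open import Data.Nat using (ℕ; _+_; _*_; _≤_; _<_)
open import Data.List using (List; []; _∷_; map; _++_)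
open import Data.Maybe using (Maybe; just; nothing)
open import Data.Product using (_×_; _,_; Σ; ∃; ∃-syntax)
open import Data.Sum using (_⊎_)
open import Data.Unit using (⊤)
open import Relation.Binary.PropositionalEquality using (_≡_; _≢_)

Var : Set
Var = ℕ

data Term : Set where
  var  : Var → Term
  num  : ℕ → Term
  _⊕_  : Term → Term → Term
  _⊗_  : ℕ → Term → Term

data PureAtom : Set where
  _≐_ _≠_ _≤ₜ_ _<ₜ_ : Term → Term → PureAtom

PureFormula : Set
PureFormula = List PureAtom

data SpatialAtom : Set where
  pto   : Term → Term → SpatialAtom
  array : Term → Term → SpatialAtom

-- a spatial formula F ::= emp | atom | F * F, represented as the list of
-- its atoms (emp = [], * = concatenation)
SpatialFormula : Set
SpatialFormula = List SpatialAtom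

record SymHeap : Set where
  constructor _∶_
  field
    pure    : PureFormula
    spatial : SpatialFormula
open SymHeap public

_⊛_ : SymHeap → SymHeap → SymHeap
(Π ∶ F) ⊛ (Π' ∶ F') = (Π ++ Π') ∶ (F ++ F')

Stack : Set
Stack = Var → ℕ

record Heap : Set where
  field
    fun   : ℕ → Maybe ℕ
    bound : ℕ
    fin   : ∀ x → bound ≤ x → fun x ≡ nothing
open Heap public

⟦_⟧ : Term → Stack → ℕ
⟦ var x ⟧ s = s x
⟦ num n ⟧ s = n
⟦ t ⊕ u ⟧ s = ⟦ t ⟧ s + ⟦ u ⟧ s
⟦ n ⊗ t ⟧ s = n * ⟦ t ⟧ s

evalAtom : Stack → PureAtom → Set
evalAtom s (t ≐ u)  = ⟦ t ⟧ s ≡ ⟦ u ⟧ s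
evalAtom s (t ≠ u)  = ⟦ t ⟧ s ≢ ⟦ u ⟧ s
evalAtom s (t ≤ₜ u) = ⟦ t ⟧ s ≤ ⟦ u ⟧ s
evalAtom s (t <ₜ u) = ⟦ t ⟧ s < ⟦ u ⟧ s

evalPure : Stack → PureFormula → Set
evalPure s []       = ⊤
evalPure s (a ∷ Π)  = evalAtom s a × evalPure s Π

-- h = h₁ ∘ h₂ : h is the union of the domain-disjoint heaps h₁ and h₂
Split : Heap → Heap → Heap → Set
Split h h₁ h₂ = ∀ x →
  (fun h₁ x ≡ nothing × fun h x ≡ fun h₂ x) ⊎
  (fun h₂ x ≡ nothing × fun h x ≡ fun h₁ x)

satAtom : Stack → Heap → SpatialAtom → Set
satAtom s h (pto t₁ t₂) =
  fun h (⟦ t₁ ⟧ s) ≡ just (⟦ t₂ ⟧ s) ×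
  (∀ x → x ≢ ⟦ t₁ ⟧ s → fun h x ≡ nothing)
satAtom s h (array t₁ t₂) =
  ⟦ t₁ ⟧ s ≤ ⟦ t₂ ⟧ s ×
  (∀ x → ⟦ t₁ ⟧ s ≤ x → x ≤ ⟦ t₂ ⟧ s → ∃[ v ] fun h x ≡ just v) ×
  (∀ x → fun h x ≢ nothing → ⟦ t₁ ⟧ s ≤ x × x ≤ ⟦ t₂ ⟧ s)

satSpatial : Stack → Heap → SpatialFormula → Set
satSpatial s h []      = ∀ x → fun h x ≡ nothing
satSpatial s h (a ∷ F) =
  Σ Heap λ h₁ → Σ Heap λ h₂ → Split h h₁ h₂ × satAtom s h₁ a × satSpatial s h₂ F

_,_⊨_ : Stack → Heap → SymHeap → Set
s , h ⊨ (Π ∶ F) = evalPure s Π × satSpatial s h F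

Satisfiable : SymHeap → Set
Satisfiable A = Σ Stack λ s → Σ Heap λ h → s , h ⊨ A

_⊨ₑ_ : SymHeap → SymHeap → Set
A ⊨ₑ B = ∀ s h → s , h ⊨ A → s , h ⊨ B

data PForm : Set where
  atom : PureAtom → PForm
  tt   : PForm
  _∧ₚ_ _∨ₚ_ : PForm → PForm → PForm

evalP : Stack → PForm → Set
evalP s (atom a)  = evalAtom s a
evalP s tt        = ⊤
evalP s (φ ∧ₚ ψ) = evalP s φ × evalP s ψ
evalP s (φ ∨ₚ ψ) = evalP s φ ⊎ evalP s ψ

PSatisfiable : PForm → Set
PSatisfiable φ = Σ Stack λ s → evalP s φ

⋀ : List PForm → PForm
⋀ []       = tt
⋀ (φ ∷ φs) = φ ∧ₚ ⋀ φs

pureToP : PureFormula → PForm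
pureToP Π = ⋀ (map atom Π)

-- ⌊C⌋ : replace c ↦ d by array(c,c); we record the array bounds
floorAtom : SpatialAtom → Term × Term
floorAtom (pto c d)   = c , c
floorAtom (array a b) = a , b

disjointP : Term × Term → Term × Term → PForm
disjointP (aᵢ , bᵢ) (aⱼ , bⱼ) = atom (bᵢ <ₜ aⱼ) ∨ₚ atom (bⱼ <ₜ aᵢ)

pairwiseDisj : List (Term × Term) → PForm
pairwiseDisj []       = tt
pairwiseDisj (p ∷ ps) = ⋀ (map (disjointP p) ps) ∧ₚ pairwiseDisj ps

γ : SymHeap → PForm
γ (Π ∶ F) =
  pureToP Π ∧ₚ
  (⋀ (map (λ p → atom (Data.Product.proj₁ p ≤ₜ Data.Product.proj₂ p)) (map floorAtom F)) ∧ₚ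
   pairwiseDisj (map floorAtom F))

mkSH : PureFormula → List (Term × Term) → List (Term × Term) → SymHeap
mkSH Π arrs ptos =
  Π ∶ (map (λ p → array (Data.Product.proj₁ p) (Data.Product.proj₂ p)) arrs ++
       map (λ p → pto (Data.Product.proj₁ p) (Data.Product.proj₂ p)) ptos)

-- β(A,B), with A = mkSH Π arrsA ptosA and B = mkSH Π' arrsB ptosB
β : PureFormula → List (Term × Term) → List (Term × Term) →
    PureFormula → List (Term × Term) → List (Term × Term) → PForm
β Π arrsA ptosA Π' arrsB ptosB =
  γ (mkSH Π arrsA ptosA) ∧ₚ (γ (mkSH Π' arrsB ptosB) ∧ₚ
  (⋀ (map (λ vw → ⋀ (map (λ ab →
        atom (Data.Product.proj₁ vw <ₜ Data.Product.proj₁ ab) ∨ₚ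
        atom (Data.Product.proj₂ ab <ₜ Data.Product.proj₁ vw)) arrsA)) ptosB) ∧ₚ
   ⋀ (map (λ tu → ⋀ (map (λ vw →
        atom (Data.Product.proj₁ tu ≠ Data.Product.proj₁ vw) ∨ₚ
        atom (Data.Product.proj₂ tu ≐ Data.Product.proj₂ vw)) ptosB)) ptosA)))

module Submission where

-- A witness of the hypothesis gives one stack s and heap h with
-- s,h ⊨ A * X, hence (by the entailment) also s,h ⊨ B * Y.  We show that
-- this very stack s satisfies β(A,B):
--   * γ(C) holds in any model of C * R: every atom of a satisfied spatial
--     formula has its interval ⌊a⌋ allocated (so its bounds are ordered),
--     and atoms in separate parts of a heap have disjoint intervals;
--   * a points-to cell v ↦ w of B lies outside every array(a,b) of A:
--     otherwise overwrite the cell s(v) by s(w)+1.  Cells inside an array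
--     may hold any value, so the new heap still models A * X, hence B * Y,
--     which forces the cell to hold s(w) — a contradiction;
--   * points-to cells t ↦ u of A and v ↦ w of B at the same address agree,
--     because both are read off the same heap h.

open import Defs
open import Data.List using (List; []; _∷_; map; _++_)
open import Data.Product using (_×_; Σ; ∃-syntax; _,_; proj₁; proj₂)
open import Data.Nat using (ℕ; suc; _≤_; _<_; _≟_; _<?_; _⊔_)
open import Data.Nat.Properties
  using (≤-refl; ≤-trans; ≤-antisym; ≮⇒≥; m≤m⊔n; m≤n⊔m; ⊔-lub; 1+n≢n; 1+n≰n)
open import Data.Maybe using (Maybe; just; nothing)
open import Data.Maybe.Properties using (just-injective)
open import Data.Sum using (_⊎_; inj₁; inj₂)
open import Data.Unit using (tt)
open import Data.Empty using (⊥-elim)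
open import Relation.Nullary using (yes; no)
open import Relation.Binary.PropositionalEquality
  using (_≡_; _≢_; refl; sym; trans; cong)
open import Data.List.Relation.Unary.Any using (here; there)
open import Data.List.Membership.Propositional using (_∈_)
open import Data.List.Membership.Propositional.Properties
  using (∈-map⁺; ∈-map⁻; ∈-++⁺ˡ; ∈-++⁺ʳ)

_∈dom_ : ℕ → Heap → Set
x ∈dom h = ∃[ v ] fun h x ≡ just v

split-left : ∀ {h h₁ h₂ x v} → Split h h₁ h₂ → fun h₁ x ≡ just v →
  fun h₂ x ≡ nothing × fun h x ≡ just v
split-left {x = x} sp e with sp x
... | inj₁ (e₁ , _) with () ← trans (sym e₁) e
... | inj₂ (e₂ , eh) = e₂ , trans eh e

split-right : ∀ {h h₁ h₂ x v} → Split h h₁ h₂ → fun h₂ x ≡ just v →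
  fun h₁ x ≡ nothing × fun h x ≡ just v
split-right {x = x} sp e with sp x
... | inj₁ (e₁ , eh) = e₁ , trans eh e
... | inj₂ (e₂ , _) with () ← trans (sym e₂) e

lo hi : Stack → SpatialAtom → ℕ
lo s a = ⟦ proj₁ (floorAtom a) ⟧ s
hi s a = ⟦ proj₂ (floorAtom a) ⟧ s

Allocated : Stack → Heap → SpatialAtom → Set
Allocated s h a = lo s a ≤ hi s a × (∀ x → lo s a ≤ x → x ≤ hi s a → x ∈dom h)

atom-allocated : ∀ s h a → satAtom s h a → Allocated s h a
atom-allocated s h (pto t u) (e , _) = ≤-refl , λ x l r → _ , subst-cell (≤-antisym l r)
  where
  subst-cell : ∀ {x} → ⟦ t ⟧ s ≡ x → fun h x ≡ just (⟦ u ⟧ s)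
  subst-cell refl = e
atom-allocated s h (array t u) (b , cover , _) = b , cover

member-allocated : ∀ s h F b → satSpatial s h F → b ∈ F → Allocated s h b
member-allocated s h (a ∷ F) .a (h₁ , h₂ , sp , sa , _) (here refl) =
  let (ord , cover) = atom-allocated s h₁ a sa in
  ord , λ x l r → let (v , e) = cover x l r in v , proj₂ (split-left {h} {h₁} {h₂} sp e)
member-allocated s h (a ∷ F) b (h₁ , h₂ , sp , _ , sF) (there m) =
  let (ord , cover) = member-allocated s h₂ F b sF m in
  ord , λ x l r → let (v , e) = cover x l r in v , proj₂ (split-right {h} {h₁} {h₂} sp e)

member-pointsTo : ∀ s h F t u → satSpatial s h F → pto t u ∈ F →
  fun h (⟦ t ⟧ s) ≡ just (⟦ u ⟧ s)
member-pointsTo s h (a ∷ F) t u (h₁ , h₂ , sp , (e , _) , _) (here refl) =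
  proj₂ (split-left {h} {h₁} {h₂} sp e)
member-pointsTo s h (a ∷ F) t u (h₁ , h₂ , sp , _ , sF) (there m) =
  proj₂ (split-right {h} {h₁} {h₂} sp (member-pointsTo s h₂ F t u sF m))

-- Atoms allocated in the two separate parts of a heap have disjoint
-- intervals: otherwise max(lo a, lo b) would lie in both parts.
separated : ∀ {s} h h₁ h₂ a b → Split h h₁ h₂ →
  Allocated s h₁ a → Allocated s h₂ b →
  evalP s (disjointP (floorAtom a) (floorAtom b))
separated {s} h h₁ h₂ a b sp (ordA , coverA) (ordB , coverB)
  with hi s a <? lo s b | hi s b <? lo s a
... | yes before | _ = inj₁ before
... | no _ | yes after = inj₂ after
... | no a≮b | no b≮a
  with coverA x (m≤m⊔n (lo s a) (lo s b)) (⊔-lub ordA (≮⇒≥ a≮b))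
     | coverB x (m≤n⊔m (lo s a) (lo s b)) (⊔-lub (≮⇒≥ b≮a) ordB)
  where x = lo s a ⊔ lo s b
...  | _ , e₁ | _ , e₂ with () ← trans (sym (proj₁ (split-left {h} {h₁} {h₂} sp e₁))) e₂

⋀-map-intro : ∀ {A : Set} s (f : A → PForm) (xs : List A) →
  (∀ x → x ∈ xs → evalP s (f x)) → evalP s (⋀ (map f xs))
⋀-map-intro s f []       k = tt
⋀-map-intro s f (x ∷ xs) k = k x (here refl) , ⋀-map-intro s f xs (λ y m → k y (there m))

pure-prefix : ∀ s Π Q → evalPure s (Π ++ Q) → evalP s (pureToP Π)
pure-prefix s []      Q _       = tt
pure-prefix s (a ∷ Π) Q (e , r) = e , pure-prefix s Π Q r

bounds-prefix : ∀ s h F G → satSpatial s h (F ++ G) →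
  evalP s (⋀ (map (λ p → atom (proj₁ p ≤ₜ proj₂ p)) (map floorAtom F)))
bounds-prefix s h []      G _                       = tt
bounds-prefix s h (a ∷ F) G (h₁ , h₂ , _ , sa , sF) =
  proj₁ (atom-allocated s h₁ a sa) , bounds-prefix s h₂ F G sF

disjoint-prefix : ∀ s h F G → satSpatial s h (F ++ G) →
  evalP s (pairwiseDisj (map floorAtom F))
disjoint-prefix s h []      G _                        = tt
disjoint-prefix s h (a ∷ F) G (h₁ , h₂ , sp , sa , sF) =
  ⋀-map-intro s _ (map floorAtom F) (λ _ m → separated-from m) ,
  disjoint-prefix s h₂ F G sF
  where
  separated-from : ∀ {p} → p ∈ map floorAtom F →
    evalP s (disjointP (floorAtom a) p)
  separated-from m with ∈-map⁻ floorAtom m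
  ... | b , b∈F , refl =
    separated h h₁ h₂ a b sp (atom-allocated s h₁ a sa)
      (member-allocated s h₂ (F ++ G) b sF (∈-++⁺ˡ b∈F))

γ-sound : ∀ s h Π F R → s , h ⊨ ((Π ∶ F) ⊛ R) → evalP s (γ (Π ∶ F))
γ-sound s h Π F R (sΠ , sF) =
  pure-prefix s Π (pure R) sΠ ,
  bounds-prefix s h F (spatial R) sF ,
  disjoint-prefix s h F (spatial R) sF

update : Heap → ℕ → ℕ → Heap
update h p v = record { fun = content ; bound = suc p ⊔ bound h ; fin = finite }
  where
  content : ℕ → Maybe ℕ
  content x with x ≟ p
  ... | yes _ = just v
  ... | no _  = fun h x
  finite : ∀ x → suc p ⊔ bound h ≤ x → content x ≡ nothing
  finite x le with x ≟ p
  ... | yes refl = ⊥-elim (1+n≰n (≤-trans (m≤m⊔n (suc p) (bound h)) le))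
  ... | no _     = fin h x (≤-trans (m≤n⊔m (suc p) (bound h)) le)

update-here : ∀ h p v → fun (update h p v) p ≡ just v
update-here h p v with p ≟ p
... | yes _ = refl
... | no p≢p = ⊥-elim (p≢p refl)

update-there : ∀ h p v x → x ≢ p → fun (update h p v) x ≡ fun h x
update-there h p v x x≢p with x ≟ p
... | yes x≡p = ⊥-elim (x≢p x≡p)
... | no _    = refl

just≢nothing : ∀ {w : ℕ} → just w ≢ nothing
just≢nothing ()

-- Case split on an address, opaque to the definition of update (a direct
-- `with x ≟ p` would also abstract the test inside update's contents).
same-or-different : (x p : ℕ) → x ≡ p ⊎ x ≢ p
same-or-different x p with x ≟ p
... | yes x≡p = inj₁ x≡p
... | no x≢p  = inj₂ x≢p

-- Overwriting an allocated cell preserves a heap's array atoms: the domain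
-- is unchanged and arrays constrain no contents.
update-array : ∀ s h p v t u → p ∈dom h → satAtom s h (array t u) →
  satAtom s (update h p v) (array t u)
update-array s h p v t u (_ , hp) (ord , cover , dom) = ord , cover′ , dom′
  where
  cover′ : ∀ x → ⟦ t ⟧ s ≤ x → x ≤ ⟦ u ⟧ s → x ∈dom update h p v
  cover′ x l r with same-or-different x p
  ... | inj₁ refl = v , update-here h p v
  ... | inj₂ x≢p   = let (w , e) = cover x l r in w , trans (update-there h p v x x≢p) e
  dom′ : ∀ x → fun (update h p v) x ≢ nothing → ⟦ t ⟧ s ≤ x × x ≤ ⟦ u ⟧ s
  dom′ x ne with same-or-different x p
  ... | inj₁ refl = dom x (λ e → just≢nothing (trans (sym hp) e))
  ... | inj₂ x≢p   = dom x (λ e → ne (trans (update-there h p v x x≢p) e))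

update-split-left : ∀ h h₁ h₂ p v → Split h h₁ h₂ → fun h₂ p ≡ nothing →
  Split (update h p v) (update h₁ p v) h₂
update-split-left h h₁ h₂ p v sp e x with same-or-different x p
... | inj₁ refl = inj₂ (e , trans (update-here h p v) (sym (update-here h₁ p v)))
... | inj₂ x≢p with sp x
...   | inj₁ (e₁ , eh) = inj₁ (trans (update-there h₁ p v x x≢p) e₁ ,
                              trans (update-there h p v x x≢p) eh)
...   | inj₂ (e₂ , eh) = inj₂ (e₂ , trans (update-there h p v x x≢p)
                                      (trans eh (sym (update-there h₁ p v x x≢p))))

update-split-right : ∀ h h₁ h₂ p v → Split h h₁ h₂ → fun h₁ p ≡ nothing →
  Split (update h p v) h₁ (update h₂ p v)
update-split-right h h₁ h₂ p v sp e x with same-or-different x p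
... | inj₁ refl = inj₁ (e , trans (update-here h p v) (sym (update-here h₂ p v)))
... | inj₂ x≢p with sp x
...   | inj₁ (e₁ , eh) = inj₁ (e₁ , trans (update-there h p v x x≢p)
                                      (trans eh (sym (update-there h₂ p v x x≢p))))
...   | inj₂ (e₂ , eh) = inj₂ (trans (update-there h₂ p v x x≢p) e₂ ,
                              trans (update-there h p v x x≢p) eh)

update-inside-array : ∀ s h F t u p v → satSpatial s h F → array t u ∈ F →
  ⟦ t ⟧ s ≤ p → p ≤ ⟦ u ⟧ s → satSpatial s (update h p v) F
update-inside-array s h (a ∷ F) t u p v (h₁ , h₂ , sp , sa , sF) (here refl) l r =
  let p∈h₁ = proj₂ (atom-allocated s h₁ (array t u) sa) p l r in
  update h₁ p v , h₂ ,
  update-split-left h h₁ h₂ p v sp (proj₁ (split-left {h} {h₁} {h₂} sp (proj₂ p∈h₁))) ,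
  update-array s h₁ p v t u p∈h₁ sa , sF
update-inside-array s h (a ∷ F) t u p v (h₁ , h₂ , sp , sa , sF) (there m) l r =
  let p∈h₂ = proj₂ (member-allocated s h₂ F (array t u) sF m) p l r in
  h₁ , update h₂ p v ,
  update-split-right h h₁ h₂ p v sp (proj₁ (split-right {h} {h₁} {h₂} sp (proj₂ p∈h₂))) ,
  sa , update-inside-array s h₂ F t u p v sF m l r

-- If P ⊨ Q, a points-to cell v ↦ w of Q lies outside every array(a,b)
-- of P in any model of P: inside, it could be overwritten by w+1.
pointsTo-outside-array : ∀ P Q → P ⊨ₑ Q → ∀ s h → s , h ⊨ P →
  ∀ a b v w → array a b ∈ spatial P → pto v w ∈ spatial Q →
  ⟦ v ⟧ s < ⟦ a ⟧ s ⊎ ⟦ b ⟧ s < ⟦ v ⟧ s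
pointsTo-outside-array P Q P⊨Q s h (sΠ , sF) a b v w a∈P v∈Q
  with ⟦ v ⟧ s <? ⟦ a ⟧ s | ⟦ b ⟧ s <? ⟦ v ⟧ s
... | yes before | _ = inj₁ before
... | no _ | yes after = inj₂ after
... | no v≮a | no b≮v = ⊥-elim (1+n≢n (just-injective (trans (sym overwritten) read)))
  where
  h′ : Heap
  h′ = update h (⟦ v ⟧ s) (suc (⟦ w ⟧ s))
  h′⊨P : s , h′ ⊨ P
  h′⊨P = sΠ , update-inside-array s h (spatial P) a b (⟦ v ⟧ s) (suc (⟦ w ⟧ s))
                sF a∈P (≮⇒≥ v≮a) (≮⇒≥ b≮v)
  read : fun h′ (⟦ v ⟧ s) ≡ just (⟦ w ⟧ s)
  read = member-pointsTo s h′ (spatial Q) v w (proj₂ (P⊨Q s h′ h′⊨P)) v∈Q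
  overwritten : fun h′ (⟦ v ⟧ s) ≡ just (suc (⟦ w ⟧ s))
  overwritten = update-here h (⟦ v ⟧ s) (suc (⟦ w ⟧ s))

pointsTo-agree : ∀ s h F G t u v w → satSpatial s h F → satSpatial s h G →
  pto t u ∈ F → pto v w ∈ G →
  ⟦ t ⟧ s ≢ ⟦ v ⟧ s ⊎ ⟦ u ⟧ s ≡ ⟦ w ⟧ s
pointsTo-agree s h F G t u v w sF sG t∈F v∈G with ⟦ t ⟧ s ≟ ⟦ v ⟧ s
... | no t≢v  = inj₁ t≢v
... | yes t≡v = inj₂ (just-injective (same-cell t≡v))
  where
  same-cell : ⟦ t ⟧ s ≡ ⟦ v ⟧ s → just (⟦ u ⟧ s) ≡ just (⟦ w ⟧ s)
  same-cell eq = trans (sym (member-pointsTo s h F t u sF t∈F))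
                        (trans (cong (fun h) eq) (member-pointsTo s h G v w sG v∈G))

arrF ptoF : Term × Term → SpatialAtom
arrF (a , b) = array a b
ptoF (t , u) = pto t u

array∈ : ∀ Π arrs ptos R {ab} → ab ∈ arrs → arrF ab ∈ spatial (mkSH Π arrs ptos ⊛ R)
array∈ Π arrs ptos R m = ∈-++⁺ˡ (∈-++⁺ˡ (∈-map⁺ arrF m))

pto∈ : ∀ Π arrs ptos R {tu} → tu ∈ ptos → ptoF tu ∈ spatial (mkSH Π arrs ptos ⊛ R)
pto∈ Π arrs ptos R m = ∈-++⁺ˡ (∈-++⁺ʳ (map arrF arrs) (∈-map⁺ ptoF m))

proposition20 : (Π : PureFormula) (arrsA ptosA : List (Term × Term))
    (Π' : PureFormula) (arrsB ptosB : List (Term × Term)) →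
    Satisfiable (mkSH Π arrsA ptosA) →
    Satisfiable (mkSH Π' arrsB ptosB) →
    Σ SymHeap (λ X → Σ SymHeap (λ Y →
    Satisfiable (mkSH Π arrsA ptosA ⊛ X) ×
    (mkSH Π arrsA ptosA ⊛ X) ⊨ₑ (mkSH Π' arrsB ptosB ⊛ Y))) →
    PSatisfiable (β Π arrsA ptosA Π' arrsB ptosB)
proposition20 Π arrsA ptosA Π' arrsB ptosB _ _ (X , Y , (s , h , h⊨AX) , AX⊨BY) =
  s , γ-sound s h Π FA X h⊨AX , γ-sound s h Π' FB Y h⊨BY ,
  ⋀-map-intro s _ ptosB (λ { (v , w) v∈ → ⋀-map-intro s _ arrsA λ { (a , b) a∈ →
    pointsTo-outside-array AX BY AX⊨BY s h h⊨AX a b v w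
      (array∈ Π arrsA ptosA X a∈) (pto∈ Π' arrsB ptosB Y v∈) } }) ,
  ⋀-map-intro s _ ptosA (λ { (t , u) t∈ → ⋀-map-intro s _ ptosB λ { (v , w) v∈ →
    pointsTo-agree s h (spatial AX) (spatial BY) t u v w (proj₂ h⊨AX) (proj₂ h⊨BY)
      (pto∈ Π arrsA ptosA X t∈) (pto∈ Π' arrsB ptosB Y v∈) } })
  where
  FA FB : SpatialFormula
  FA = map arrF arrsA ++ map ptoF ptosA
  FB = map arrF arrsB ++ map ptoF ptosB
  AX BY : SymHeap
  AX = mkSH Π arrsA ptosA ⊛ X
  BY = mkSH Π' arrsB ptosB ⊛ Y
  h⊨BY : s , h ⊨ BY
  h⊨BY = AX⊨BY s h h⊨AX
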